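{- For every integer $n\geq 4$, $pd(K_n\odot W_{n+2})\leq n$.
   Context: For a connected graph $G$ and an ordered partition $\Pi=\{S_1,\dots,S_k\}$ of $V(G)$, $r(v\mid\Pi)=(d(v,S_1),\dots,d(v,S_k))$ where $d(v,S)=\min_{x\in S}d(v,x)$ with $d$ the shortest-path distance; $\Pi$ is resolving if $r(u\mid\Pi)\neq r(v\mid\Pi)$ for all distinct $u,v$; $pd(G)$ is the minimum size of a resolving partition. $K_n$ is the complete graph; the wheel $W_m$ ($m\geq3$) is the cycle $C_m$ plus a center vertex adjacent to all cycle vertices. The corona product $G\odot H$, $|V(G)|=n$, is obtained from $G$ and $n$ disjoint copies $H_1,\dots,H_n$ of $H$ by joining the $i$-th vertex of $G$ to every vertex of $H_i$. -}

module Defs where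

open import Level using (0ℓ)
open import Data.Nat using (ℕ; zero; suc; _+_; _≤_)
open import Data.Fin using (Fin; toℕ)
open import Data.Maybe using (Maybe; just; nothing)
open import Data.Product using (Σ; ∃; ∃-syntax; _×_; _,_)
open import Data.Sum using (_⊎_; inj₁; inj₂)
open import Data.Empty using (⊥)
open import Data.Unit using (⊤)
open import Relation.Nullary using (¬_)
open import Relation.Binary.PropositionalEquality using (_≡_; _≢_)

record Graph : Set₁ where
  field
    V   : Set
    Adj : V → V → Set
open Graph public

data Walk (G : Graph) : V G → V G → ℕ → Set where
  here : ∀ {u} → Walk G u u 0
  step : ∀ {u w v k} → Adj G u w → Walk G w v k → Walk G u v (suc k)

-- d(v, S) = m : m is the minimum length of a walk from v to a vertex of S
-- (equivalently, the minimum shortest-path distance d(v,x) over x ∈ S).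
DistToSet : (G : Graph) → V G → (V G → Set) → ℕ → Set
DistToSet G v S m =
  (∃[ x ] (S x × Walk G v x m)) ×
  (∀ x k → S x → Walk G v x k → m ≤ k)

-- An ordered partition {S_1,…,S_k} of V(G) into k nonempty classes,
-- given by the class map; S_i = { v | cls v ≡ i }.
record OrderedPartition (G : Graph) (k : ℕ) : Set where
  field
    cls      : V G → Fin k
    nonempty : ∀ (i : Fin k) → ∃[ v ] (cls v ≡ i)
open OrderedPartition public

Class : ∀ {G k} → OrderedPartition G k → Fin k → V G → Set
Class Π i v = cls Π v ≡ i

SameRep : ∀ {G k} → OrderedPartition G k → V G → V G → Set
SameRep {G} Π u v =
  ∀ i m → (DistToSet G u (Class Π i) m → DistToSet G v (Class Π i) m)
        × (DistToSet G v (Class Π i) m → DistToSet G u (Class Π i) m)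

Resolving : ∀ {G k} → OrderedPartition G k → Set
Resolving {G} Π = ∀ (u v : V G) → u ≢ v → ¬ SameRep Π u v

-- pd(G) ≤ n  :⇔  some resolving partition has at most n classes
-- (pd(G) is the minimum size of a resolving partition).
PdAtMost : Graph → ℕ → Set
PdAtMost G n = ∃[ k ] (k ≤ n × Σ (OrderedPartition G k) Resolving)

K : ℕ → Graph
K n = record { V = Fin n ; Adj = λ i j → i ≢ j }

-- Cycle C_m on Fin m: i ~ i+1 (mod m), symmetrised.
CycStep : (m : ℕ) → Fin m → Fin m → Set
CycStep m i j = (toℕ j ≡ suc (toℕ i)) ⊎ ((suc (toℕ i) ≡ m) × (toℕ j ≡ 0))

CycAdj : (m : ℕ) → Fin m → Fin m → Set
CycAdj m i j = CycStep m i j ⊎ CycStep m j i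

-- Wheel W_m: cycle vertices just i, center nothing.
WheelAdj : (m : ℕ) → Maybe (Fin m) → Maybe (Fin m) → Set
WheelAdj m nothing  nothing  = ⊥
WheelAdj m nothing  (just _) = ⊤
WheelAdj m (just _) nothing  = ⊤
WheelAdj m (just i) (just j) = CycAdj m i j

W : ℕ → Graph
W m = record { V = Maybe (Fin m) ; Adj = WheelAdj m }

-- Corona product G ⊙ H: vertices inj₁ g (vertices of G) and
-- inj₂ (g , h) (vertex h of the copy H_g attached to g).
CoronaAdj : (G H : Graph) → (V G ⊎ (V G × V H)) → (V G ⊎ (V G × V H)) → Set
CoronaAdj G H (inj₁ i) (inj₁ j) = Adj G i j
CoronaAdj G H (inj₁ i) (inj₂ (j , _)) = i ≡ j
CoronaAdj G H (inj₂ (i , _)) (inj₁ j) = i ≡ j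
CoronaAdj G H (inj₂ (i , x)) (inj₂ (j , y)) = (i ≡ j) × Adj H x y

_⊙_ : Graph → Graph → Graph
G ⊙ H = record { V = V G ⊎ (V G × V H) ; Adj = CoronaAdj G H }

-- Label the wheel W_{n+2} onto {0, …, n − 2} so that two vertices with equal labels are told apart by a
-- nonzero label carried by a neighbour of one of them and by no neighbour of the other. In K_n ⊙ W_{n+2} put
-- every hub into class 0 and the wheel vertex a of the i-th copy into class ℓ(a) with i punched out, so that
-- the i-th copy avoids class i. For i ≠ 0 the i-th copy is then at distance exactly 3 from class i, whereas
-- every hub and every vertex of another copy is within distance 2 of it; two hubs j ≠ i are told apart by
-- class i, met by hub j at distance 1 but not by hub i; and twins inside one copy are told apart by the
-- class of their separating label, which differs from the hubs' class 0 because that label is nonzero.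
module Submission where

open import Defs
open import Data.Nat using (ℕ; _≤_; _+_)
open import Data.Nat using (suc; z≤n; s≤s; _≤?_)
open import Data.Nat.Properties using (≤-refl; ≤⇒≯; ≰⇒>; +-comm; suc-injective)
open import Data.Fin using (Fin; zero; suc; fromℕ; punchIn; punchOut)
open import Data.Fin.Properties
  using (_≟_; toℕ-injective; toℕ-fromℕ; punchIn-injective; punchInᵢ≢i; punchIn-punchOut)
open import Data.Maybe using (just; nothing)
open import Data.Product using (∃-syntax; _×_; _,_; proj₁; proj₂)
open import Data.Sum using (_⊎_; inj₁; inj₂)
open import Data.Empty using (⊥-elim)
open import Relation.Nullary using (¬_; yes; no)
open import Relation.Binary.PropositionalEquality

Reaches : (G : Graph) → V G → (V G → Set) → ℕ → Set
Reaches G v S d = ∃[ x ] (S x × Walk G v x d)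

ReachesWithin : (G : Graph) → V G → (V G → Set) → ℕ → Set
ReachesWithin G v S d = ∃[ l ] (l ≤ d × Reaches G v S l)

module _ {G : Graph} {k : ℕ} (Π : OrderedPartition G k) where

  SameRep-sym : ∀ {u v} → SameRep Π u v → SameRep Π v u
  SameRep-sym s i d = proj₂ (s i d) , proj₁ (s i d)

  ¬SameRep-cls : ∀ {u v} → cls Π u ≢ cls Π v → ¬ SameRep Π u v
  ¬SameRep-cls {u} {v} u≢v s with proj₁ (s (cls Π u) 0) ((u , refl , here) , λ _ _ _ _ → z≤n)
  ... | (_ , v∈ , here) , _ = u≢v (sym v∈)

  distToSet-neighbour : ∀ {u x c} → Adj G u x → cls Π x ≡ c → cls Π u ≢ c →
                        DistToSet G u (Class Π c) 1
  distToSet-neighbour {u} {x} ux x∈c u∉c = (x , x∈c , step ux here) , nonzero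
    where
    nonzero : ∀ y l → Class Π _ y → Walk G u y l → 1 ≤ l
    nonzero y _ y∈c here = ⊥-elim (u∉c y∈c)
    nonzero y _ _ (step _ _) = s≤s z≤n

  ¬SameRep-neighbour : ∀ {u v x c} → Adj G u x → cls Π x ≡ c → cls Π u ≢ c →
                       (∀ y → Adj G v y → cls Π y ≢ c) → ¬ SameRep Π u v
  ¬SameRep-neighbour ux x∈c u∉c v-avoids s
    with proj₁ (s _ 1) (distToSet-neighbour ux x∈c u∉c)
  ... | (y , y∈c , step vy here) , _ = v-avoids y vy y∈c

  ¬SameRep-far : ∀ {u v c d} → DistToSet G u (Class Π c) (suc d) →
                 ReachesWithin G v (Class Π c) d → ¬ SameRep Π u v
  ¬SameRep-far u-far (l , l≤d , x , x∈c , w) s =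
    ≤⇒≯ l≤d (proj₂ (proj₁ (s _ _) u-far) x l x∈c w)

record Separates (H : Graph) {l : ℕ} (ℓ : V H → Fin (suc l)) (a b : V H) : Set where
  field
    witness  : V H
    adjacent : Adj H a witness
    nonzero  : ℓ witness ≢ zero
    fresh    : ℓ witness ≢ ℓ a
    absent   : ∀ y → Adj H b y → ℓ y ≢ ℓ witness

TwinSeparating : (H : Graph) {l : ℕ} → (V H → Fin (suc l)) → Set
TwinSeparating H ℓ = ∀ a b → a ≢ b → ℓ a ≡ ℓ b → Separates H ℓ a b ⊎ Separates H ℓ b a

punchIn≡zero⇒≡zero : ∀ {n} (i : Fin (suc (suc n))) (j : Fin (suc n)) → punchIn i j ≡ zero → j ≡ zero
punchIn≡zero⇒≡zero (suc i) zero _ = refl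

distinct⇒one-≢ : ∀ {n} {i j : Fin n} (i≢j : i ≢ j) {z : Fin n} → i ≢ z ⊎ j ≢ z
distinct⇒one-≢ {i = i} i≢j {z} with i ≟ z
... | yes refl = inj₂ (λ j≡z → i≢j (sym j≡z))
... | no i≢z = inj₁ i≢z

module CoronaOfComplete {l : ℕ} (H : Graph) (ℓ : V H → Fin (suc l))
       (ℓ-surjective : ∀ c → ∃[ a ] ℓ a ≡ c) (ℓ-twins : TwinSeparating H ℓ) where

  G : Graph
  G = K (suc (suc l)) ⊙ H

  colour : V G → Fin (suc (suc l))
  colour (inj₁ _) = zero
  colour (inj₂ (i , a)) = punchIn i (ℓ a)

  leaf-coloured : ∀ {j c} → j ≢ c → ∃[ a ] colour (inj₂ (j , a)) ≡ c
  leaf-coloured j≢c with ℓ-surjective (punchOut j≢c)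
  ... | a , ℓa≡ = a , trans (cong (punchIn _) ℓa≡) (punchIn-punchOut j≢c)

  Π : OrderedPartition G (suc (suc l))
  Π = record { cls = colour ; nonempty = colour-surjective }
    where
    colour-surjective : ∀ c → ∃[ v ] colour v ≡ c
    colour-surjective zero = inj₁ zero , refl
    colour-surjective (suc c) with leaf-coloured {zero} {suc c} (λ ())
    ... | a , a∈c = inj₂ (zero , a) , a∈c

  hub-colour≢ : ∀ {i} j → i ≢ zero → colour (inj₁ j) ≢ i
  hub-colour≢ _ i≢0 0≡i = i≢0 (sym 0≡i)

  leaf-colour≢ : ∀ i a → colour (inj₂ (i , a)) ≢ i
  leaf-colour≢ i a = punchInᵢ≢i i (ℓ a)

  hub-neighbour-colour≢ : ∀ {i y} → i ≢ zero → Adj G (inj₁ i) y → colour y ≢ i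
  hub-neighbour-colour≢ {y = inj₁ j} i≢0 _ = hub-colour≢ j i≢0
  hub-neighbour-colour≢ {y = inj₂ (_ , a)} _ refl = leaf-colour≢ _ a

  -- Within two steps of a vertex of H_i one only meets hubs and vertices of H_i.
  near-leaf-colour≢ : ∀ {i a y l} → i ≢ zero → Walk G (inj₂ (i , a)) y l → l ≤ 2 → colour y ≢ i
  near-leaf-colour≢ {i} {a} _ here _ = leaf-colour≢ i a
  near-leaf-colour≢ i≢0 (step {w = inj₁ j} _ here) _ = hub-colour≢ j i≢0
  near-leaf-colour≢ _ (step {w = inj₂ (_ , b)} (refl , _) here) _ = leaf-colour≢ _ b
  near-leaf-colour≢ i≢0 (step _ (step {w = inj₁ j} _ here)) _ = hub-colour≢ j i≢0
  near-leaf-colour≢ _ (step {w = inj₁ _} refl (step {w = inj₂ (_ , b)} refl here)) _ = leaf-colour≢ _ b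
  near-leaf-colour≢ _ (step {w = inj₂ _} (refl , _) (step {w = inj₂ (_ , b)} (refl , _) here)) _ =
    leaf-colour≢ _ b
  near-leaf-colour≢ _ (step _ (step _ (step _ _))) (s≤s (s≤s ()))

  hub-reaches-other : ∀ {i j} → j ≢ i → Reaches G (inj₁ j) (Class Π i) 1
  hub-reaches-other j≢i with leaf-coloured j≢i
  ... | a , a∈i = inj₂ (_ , a) , a∈i , step refl here

  hub-reaches-own : ∀ {i} → i ≢ zero → Reaches G (inj₁ i) (Class Π i) 2
  hub-reaches-own i≢0 with hub-reaches-other (λ 0≡i → i≢0 (sym 0≡i))
  ... | x , x∈i , w = x , x∈i , step i≢0 w

  hub-within-two : ∀ {i} j → i ≢ zero → ReachesWithin G (inj₁ j) (Class Π i) 2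
  hub-within-two {i} j i≢0 with j ≟ i
  ... | yes refl = 2 , ≤-refl , hub-reaches-own i≢0
  ... | no j≢i = 1 , s≤s z≤n , hub-reaches-other j≢i

  leaf-within-two : ∀ {i j} b → j ≢ i → ReachesWithin G (inj₂ (j , b)) (Class Π i) 2
  leaf-within-two b j≢i with hub-reaches-other j≢i
  ... | x , x∈i , w = 2 , ≤-refl , x , x∈i , step refl w

  leaf-distance-three : ∀ {i} a → i ≢ zero → DistToSet G (inj₂ (i , a)) (Class Π i) 3
  leaf-distance-three a i≢0 with hub-reaches-own i≢0
  ... | x , x∈i , w = (x , x∈i , step refl w) , far
    where
    far : ∀ y l → Class Π _ y → Walk G (inj₂ (_ , a)) y l → 3 ≤ l
    far y l y∈i w with l ≤? 2
    ... | yes l≤2 = ⊥-elim (near-leaf-colour≢ i≢0 w l≤2 y∈i)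
    ... | no l≰2 = ≰⇒> l≰2

  leaf-resolved : ∀ {i a v} → i ≢ zero → ReachesWithin G v (Class Π i) 2 →
                  ¬ SameRep Π (inj₂ (i , a)) v
  leaf-resolved {a = a} i≢0 = ¬SameRep-far Π (leaf-distance-three a i≢0)

  hubs-resolved : ∀ {i j} → i ≢ zero → j ≢ i → ¬ SameRep Π (inj₁ j) (inj₁ i)
  hubs-resolved {j = j} i≢0 j≢i with leaf-coloured j≢i
  ... | a , a∈i = ¬SameRep-neighbour Π refl a∈i (hub-colour≢ j i≢0)
                    (λ y iy → hub-neighbour-colour≢ {y = y} i≢0 iy)

  twins-resolved : ∀ {i a b} → Separates H ℓ a b → ¬ SameRep Π (inj₂ (i , a)) (inj₂ (i , b))
  twins-resolved {i} sep =
    ¬SameRep-neighbour Π (refl , adjacent) refl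
      (λ e → fresh (sym (punchIn-injective i _ _ e))) b-avoids
    where
    open Separates sep
    b-avoids : ∀ y → Adj G (inj₂ (i , _)) y → colour y ≢ colour (inj₂ (i , witness))
    b-avoids (inj₁ _) _ 0≡ = nonzero (punchIn≡zero⇒≡zero i _ (sym 0≡))
    b-avoids (inj₂ (_ , y)) (refl , by) e = absent y by (punchIn-injective i _ _ e)

  same-colour-resolved : ∀ u v → u ≢ v → colour u ≡ colour v → ¬ SameRep Π u v
  same-colour-resolved (inj₁ i) (inj₁ j) u≢v _ s with distinct⇒one-≢ (λ i≡j → u≢v (cong inj₁ i≡j))
  ... | inj₁ i≢0 = hubs-resolved i≢0 (λ j≡i → u≢v (cong inj₁ (sym j≡i))) (SameRep-sym Π s)
  ... | inj₂ j≢0 = hubs-resolved j≢0 (λ i≡j → u≢v (cong inj₁ i≡j)) s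
  same-colour-resolved (inj₁ j) (inj₂ (suc i , a)) _ _ s =
    leaf-resolved (λ ()) (hub-within-two j (λ ())) (SameRep-sym Π s)
  same-colour-resolved (inj₂ (suc i , a)) (inj₁ j) _ _ =
    leaf-resolved (λ ()) (hub-within-two j (λ ()))
  same-colour-resolved (inj₂ (i , a)) (inj₂ (j , b)) u≢v eq s with i ≟ j
  ... | yes refl
    with ℓ-twins a b (λ a≡b → u≢v (cong (λ c → inj₂ (i , c)) a≡b)) (punchIn-injective i _ _ eq)
  ...   | inj₁ a∣b = twins-resolved a∣b s
  ...   | inj₂ b∣a = twins-resolved b∣a (SameRep-sym Π s)
  same-colour-resolved (inj₂ (i , a)) (inj₂ (j , b)) u≢v eq s | no i≢j with distinct⇒one-≢ i≢j
  ...   | inj₁ i≢0 = leaf-resolved i≢0 (leaf-within-two b (λ j≡i → i≢j (sym j≡i))) s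
  ...   | inj₂ j≢0 = leaf-resolved j≢0 (leaf-within-two a i≢j) (SameRep-sym Π s)

  resolving : Resolving Π
  resolving u v u≢v with colour u ≟ colour v
  ... | yes eq = same-colour-resolved u v u≢v eq
  ... | no neq = ¬SameRep-cls Π neq

corona-pd≤ : ∀ {l} (H : Graph) (ℓ : V H → Fin (suc l)) → (∀ c → ∃[ a ] ℓ a ≡ c) → TwinSeparating H ℓ →
             PdAtMost (K (suc (suc l)) ⊙ H) (suc (suc l))
corona-pd≤ H ℓ ℓ-surjective ℓ-twins = _ , ≤-refl , Π , resolving
  where open CoronaOfComplete H ℓ ℓ-surjective ℓ-twins

module WheelLabelling (k : ℕ) where

  Wheel : Graph
  Wheel = W (6 + k)

  label : V Wheel → Fin (3 + k)
  label nothing = zero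
  label (just zero) = zero
  label (just (suc zero)) = zero
  label (just (suc (suc zero))) = zero
  label (just (suc (suc (suc zero)))) = suc zero
  label (just (suc (suc (suc (suc zero))))) = suc zero
  label (just (suc (suc (suc (suc (suc t)))))) = suc (suc t)

  p₀ p₁ p₂ p₃ p₄ p₅ pₗ : Fin (6 + k)
  p₀ = zero
  p₁ = suc zero
  p₂ = suc (suc zero)
  p₃ = suc (suc (suc zero))
  p₄ = suc (suc (suc (suc zero)))
  p₅ = suc (suc (suc (suc (suc zero))))
  pₗ = fromℕ (5 + k)

  label-surjective : ∀ c → ∃[ a ] label a ≡ c
  label-surjective zero = nothing , refl
  label-surjective (suc zero) = just p₃ , refl
  label-surjective (suc (suc t)) = just (suc (suc (suc (suc (suc t))))) , refl

  p₀-neighbour-label≢one : ∀ y → Adj Wheel (just p₀) y → label y ≢ suc zero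
  p₀-neighbour-label≢one nothing _ = λ ()
  p₀-neighbour-label≢one (just r) (inj₁ (inj₁ r≡1)) rewrite toℕ-injective {j = p₁} r≡1 = λ ()
  p₀-neighbour-label≢one (just r) (inj₂ (inj₂ (r+1≡m , _)))
    rewrite toℕ-injective {j = pₗ} (trans (suc-injective r+1≡m) (sym (toℕ-fromℕ _))) = λ ()

  p₁-neighbour-label≡zero : ∀ y → Adj Wheel (just p₁) y → label y ≡ zero
  p₁-neighbour-label≡zero nothing _ = refl
  p₁-neighbour-label≡zero (just r) (inj₁ (inj₁ r≡2)) rewrite toℕ-injective {j = p₂} r≡2 = refl
  p₁-neighbour-label≡zero (just r) (inj₂ (inj₁ 1≡r+1))
    rewrite toℕ-injective {j = p₀} (suc-injective (sym 1≡r+1)) = refl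

  p₂-neighbour-label≢two : ∀ y → Adj Wheel (just p₂) y → label y ≢ suc (suc zero)
  p₂-neighbour-label≢two nothing _ = λ ()
  p₂-neighbour-label≢two (just r) (inj₁ (inj₁ r≡3)) rewrite toℕ-injective {j = p₃} r≡3 = λ ()
  p₂-neighbour-label≢two (just r) (inj₂ (inj₁ 2≡r+1))
    rewrite toℕ-injective {j = p₁} (suc-injective (sym 2≡r+1)) = λ ()

  p₃-neighbour-label≢two : ∀ y → Adj Wheel (just p₃) y → label y ≢ suc (suc zero)
  p₃-neighbour-label≢two nothing _ = λ ()
  p₃-neighbour-label≢two (just r) (inj₁ (inj₁ r≡4)) rewrite toℕ-injective {j = p₄} r≡4 = λ ()
  p₃-neighbour-label≢two (just r) (inj₂ (inj₁ 3≡r+1))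
    rewrite toℕ-injective {j = p₂} (suc-injective (sym 3≡r+1)) = λ ()

  Sep : V Wheel → V Wheel → Set
  Sep = Separates Wheel label

  nonzero-neighbour∣p₁ : ∀ {a} x → Adj Wheel a x → label x ≢ zero → label a ≡ zero → Sep a (just p₁)
  nonzero-neighbour∣p₁ x ax x≢0 a≡0 = record
    { witness = x ; adjacent = ax ; nonzero = x≢0 ; fresh = λ x≡a → x≢0 (trans x≡a a≡0)
    ; absent = λ y p₁y y≡x → x≢0 (trans (sym y≡x) (p₁-neighbour-label≡zero y p₁y)) }

  centre∣p₀ : Sep nothing (just p₀)
  centre∣p₀ = record
    { witness = just p₃ ; adjacent = _ ; nonzero = λ () ; fresh = λ ()
    ; absent = p₀-neighbour-label≢one }

  centre∣p₁ : Sep nothing (just p₁)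
  centre∣p₁ = nonzero-neighbour∣p₁ (just p₃) _ (λ ()) refl

  centre∣p₂ : Sep nothing (just p₂)
  centre∣p₂ = record
    { witness = just p₅ ; adjacent = _ ; nonzero = λ () ; fresh = λ ()
    ; absent = p₂-neighbour-label≢two }

  p₀∣p₁ : Sep (just p₀) (just p₁)
  p₀∣p₁ = nonzero-neighbour∣p₁ (just pₗ) (inj₂ (inj₂ (cong suc (toℕ-fromℕ _) , refl))) (λ ()) refl

  p₂∣p₀ : Sep (just p₂) (just p₀)
  p₂∣p₀ = record
    { witness = just p₃ ; adjacent = inj₁ (inj₁ refl) ; nonzero = λ () ; fresh = λ ()
    ; absent = p₀-neighbour-label≢one }

  p₂∣p₁ : Sep (just p₂) (just p₁)
  p₂∣p₁ = nonzero-neighbour∣p₁ (just p₃) (inj₁ (inj₁ refl)) (λ ()) refl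

  p₄∣p₃ : Sep (just p₄) (just p₃)
  p₄∣p₃ = record
    { witness = just p₅ ; adjacent = inj₁ (inj₁ refl) ; nonzero = λ () ; fresh = λ ()
    ; absent = p₃-neighbour-label≢two }

  data LabelledZero : V Wheel → Set where
    centre : LabelledZero nothing
    at₀    : LabelledZero (just p₀)
    at₁    : LabelledZero (just p₁)
    at₂    : LabelledZero (just p₂)

  data LabelledOne : V Wheel → Set where
    at₃ : LabelledOne (just p₃)
    at₄ : LabelledOne (just p₄)

  labelled-zero : ∀ a → label a ≡ zero → LabelledZero a
  labelled-zero nothing _ = centre
  labelled-zero (just zero) _ = at₀
  labelled-zero (just (suc zero)) _ = at₁
  labelled-zero (just (suc (suc zero))) _ = at₂
  labelled-zero (just (suc (suc (suc zero)))) ()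
  labelled-zero (just (suc (suc (suc (suc zero))))) ()
  labelled-zero (just (suc (suc (suc (suc (suc _)))))) ()

  labelled-one : ∀ a → label a ≡ suc zero → LabelledOne a
  labelled-one (just (suc (suc (suc zero)))) _ = at₃
  labelled-one (just (suc (suc (suc (suc zero))))) _ = at₄
  labelled-one nothing ()
  labelled-one (just zero) ()
  labelled-one (just (suc zero)) ()
  labelled-one (just (suc (suc zero))) ()
  labelled-one (just (suc (suc (suc (suc (suc _)))))) ()

  labelled-tail : ∀ a t → label a ≡ suc (suc t) → a ≡ just (suc (suc (suc (suc (suc t)))))
  labelled-tail (just (suc (suc (suc (suc (suc _)))))) _ refl = refl

  Separated : V Wheel → V Wheel → Set
  Separated a b = Sep a b ⊎ Sep b a

  separated-zero : ∀ {a b} → LabelledZero a → LabelledZero b → a ≢ b → Separated a b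
  separated-zero centre at₀ _ = inj₁ centre∣p₀
  separated-zero centre at₁ _ = inj₁ centre∣p₁
  separated-zero centre at₂ _ = inj₁ centre∣p₂
  separated-zero at₀ at₁ _ = inj₁ p₀∣p₁
  separated-zero at₂ at₀ _ = inj₁ p₂∣p₀
  separated-zero at₂ at₁ _ = inj₁ p₂∣p₁
  separated-zero at₀ centre _ = inj₂ centre∣p₀
  separated-zero at₁ centre _ = inj₂ centre∣p₁
  separated-zero at₂ centre _ = inj₂ centre∣p₂
  separated-zero at₁ at₀ _ = inj₂ p₀∣p₁
  separated-zero at₀ at₂ _ = inj₂ p₂∣p₀
  separated-zero at₁ at₂ _ = inj₂ p₂∣p₁
  separated-zero centre centre a≢a = ⊥-elim (a≢a refl)
  separated-zero at₀ at₀ a≢a = ⊥-elim (a≢a refl)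
  separated-zero at₁ at₁ a≢a = ⊥-elim (a≢a refl)
  separated-zero at₂ at₂ a≢a = ⊥-elim (a≢a refl)

  separated-one : ∀ {a b} → LabelledOne a → LabelledOne b → a ≢ b → Separated a b
  separated-one at₄ at₃ _ = inj₁ p₄∣p₃
  separated-one at₃ at₄ _ = inj₂ p₄∣p₃
  separated-one at₃ at₃ a≢a = ⊥-elim (a≢a refl)
  separated-one at₄ at₄ a≢a = ⊥-elim (a≢a refl)

  label-twin-separating : TwinSeparating Wheel label
  label-twin-separating a b a≢b ℓa≡ℓb with label a in ℓa
  ... | zero = separated-zero (labelled-zero a ℓa) (labelled-zero b (sym ℓa≡ℓb)) a≢b
  ... | suc zero = separated-one (labelled-one a ℓa) (labelled-one b (sym ℓa≡ℓb)) a≢b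
  ... | suc (suc t) =
    ⊥-elim (a≢b (trans (labelled-tail a t ℓa) (sym (labelled-tail b t (sym ℓa≡ℓb)))))

lemma3p6 : ∀ (n : ℕ) → 4 ≤ n → PdAtMost (K n ⊙ W (n + 2)) n
lemma3p6 _ (s≤s (s≤s (s≤s (s≤s {n = k} _)))) =
  subst (λ m → PdAtMost (K (4 + k) ⊙ W m) (4 + k)) (cong (4 +_) (+-comm 2 k))
        (corona-pd≤ Wheel label label-surjective label-twin-separating)
  where open WheelLabelling k
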